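{- Let $M$ be a monotonic machine over a finite alphabet $\Sigma$. Then the transformed machine $S(M)$ is also monotonic.
   Context: A machine $M$ is a finite DAG whose edges $e$ carry labels $\mathrm{lab}(e) \in \Sigma$, with a designated initial state $i$ that has no incoming edges. If $(w,v)$ is an edge, then $w$ is a parent state of $v$; ancestors are obtained by iterating this relation. A sequence $s = s_1 \cdots s_L$ covers a state $v$ if there exist indices $i_1 < \dots < i_N$ and a directed path from the initial state to $v$ of $N$ edges labeled, in order, $s_{i_1}, \dots, s_{i_N}$. The initial state is covered by every sequence. A machine is monotonic if every sequence covering a state also covers every parent state of that state. Construction of $S(M)$. For a set $V$ of states and $a \in \Sigma$: - $\mathrm{sub}(V;a) = \{w : (w,v) \text{ is an edge labeled } a,\ v \in V\}$; - $\mathrm{par}(V;a) = \min(\mathrm{sub}(V;a) \cup V)$, where $\min(X)$ keeps the states of $X$ with no proper ancestor in $X$; - $\mathrm{inc}(V)$ is the set of labels of edges entering states of $V$; - $\mathrm{cl}(V) = \{V\} \cup \bigcup_{a \in \mathrm{inc}(V)} \mathrm{cl}(\mathrm{par}(V;a))$, with $\mathrm{cl}(V) = \{V\}$ if $\mathrm{inc}(V) = \emptyset$. The states of $S(M)$ are the members of $\bigcup_{v \in V(M)} \mathrm{cl}(\{v\})$. For each state $V$ and each $a \in \mathrm{inc}(V)$, $S(M)$ has an edge labeled $a$ from $\mathrm{par}(V;a)$ to $V$. Its initial state is $\{i\}$. -}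

module Defs where

open import Data.Nat using (ℕ)
open import Data.Fin using (Fin)
open import Data.Fin.Subset using (Subset; ⁅_⁆) renaming (_∈_ to _∈ₛ_)
open import Data.List using (List; []; _∷_)
open import Data.List.Membership.Propositional using (_∈_)
open import Data.List.Relation.Binary.Sublist.Propositional using (_⊆_)
open import Data.Product using (Σ; ∃; ∃-syntax; _×_; _,_)
open import Data.Sum using (_⊎_)
open import Relation.Nullary using (¬_)

module Generic {S : Set} {k : ℕ} (E : S → Fin k → S → Set) where

  data PathFrom : S → List (Fin k) → S → Set where
    nil  : ∀ {x} → PathFrom x [] x
    cons : ∀ {x a y ws z} → E x a y → PathFrom y ws z → PathFrom x (a ∷ ws) z

  Covers : S → List (Fin k) → S → Set
  Covers i s v = ∃[ ws ] (PathFrom i ws v × ws ⊆ s)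

  Monotonic : S → Set
  Monotonic i = ∀ (s : List (Fin k)) (w : S) (a : Fin k) (v : S) →
                E w a v → Covers i s v → Covers i s w

record Machine (n k : ℕ) : Set where
  field
    edges : List (Fin n × Fin k × Fin n)
    init  : Fin n

module _ {n k : ℕ} (M : Machine n k) where
  open Machine M

  Edge : Fin n → Fin k → Fin n → Set
  Edge w a v = (w , a , v) ∈ edges

  data Anc : Fin n → Fin n → Set where
    par  : ∀ {x a y} → Edge x a y → Anc x y
    step : ∀ {x a y z} → Edge x a y → Anc y z → Anc x z

  IsMachine : Set
  IsMachine = (∀ v → ¬ Anc v v) × (∀ w a → ¬ Edge w a init)

  IsMonotonic : Set
  IsMonotonic = Generic.Monotonic Edge init

  InSub : Subset n → Fin k → Fin n → Set
  InSub V a w = ∃[ v ] (v ∈ₛ V × Edge w a v)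

  InSubU : Subset n → Fin k → Fin n → Set
  InSubU V a x = InSub V a x ⊎ x ∈ₛ V

  IsPar : Subset n → Fin k → Subset n → Set
  IsPar V a W = ∀ x →
    (x ∈ₛ W → (InSubU V a x × (∀ y → InSubU V a y → ¬ Anc y x))) ×
    ((InSubU V a x × (∀ y → InSubU V a y → ¬ Anc y x)) → x ∈ₛ W)

  InInc : Subset n → Fin k → Set
  InInc V a = ∃[ w ] ∃[ v ] (v ∈ₛ V × Edge w a v)

  data Cl (V : Subset n) : Subset n → Set where
    here : Cl V V
    there : ∀ {a W U} → InInc V a → IsPar V a W → Cl W U → Cl V U

  SState : Subset n → Set
  SState U = ∃[ v ] Cl ⁅ v ⁆ U

  SEdge : Subset n → Fin k → Subset n → Set
  SEdge W a V = SState V × InInc V a × IsPar V a W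

  SInit : Subset n
  SInit = ⁅ init ⁆

  SIsMonotonic : Set
  SIsMonotonic = Generic.Monotonic SEdge SInit

-- A sequence covers a state V of S(M) exactly when it covers some element of V in M.
-- Forwards, each edge par(V;a) → V of an S(M)-path either stays inside V or follows an
-- M-edge labelled a. Backwards, peel off the last edge z →a u of a covering path into V:
-- a minimal element of sub(V;a) ∪ V below z lies in par(V;a) and is still covered, by
-- monotonicity of M, so induction builds the S(M)-path; it ends at {i} because the only
-- state of S(M) containing i is {i}. Given an edge W = par(V;a) →a V of S(M), a covered
-- element u ∈ V thus has a minimal element of sub(V;a) ∪ V below it, which lies in W and
-- is again covered by monotonicity of M.
module Submission where

open import Defs
open import Data.Nat using (ℕ; _<_; s≤s)
open import Data.Nat.Induction using (<-wellFounded)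
open import Data.Nat.Properties using (+-comm)
open import Data.Fin using (Fin) renaming (_≟_ to _≟ᶠ_)
open import Data.Fin.Induction using (spo-wellFounded; spo-noetherian)
open import Data.Fin.Properties using (any?; all?)
open import Data.Fin.Subset using (Subset; ⁅_⁆) renaming (_∈_ to _∈ₛ_)
open import Data.Fin.Subset.Properties using (x∈⁅x⁆; x∈⁅y⁆⇒x≡y; ⊆-antisym) renaming (_∈?_ to _∈ₛ?_)
open import Data.List using (List; []; _∷_; _++_; [_]; length)
open import Data.List.Properties using (++-assoc; length-++)
open import Data.List.Relation.Binary.Sublist.Propositional using (_⊆_; []; ⊆-refl; ⊆-trans)
open import Data.List.Relation.Binary.Sublist.Propositional.Properties using (++⁺; ++⁺ʳ; length-mono-≤)
open import Data.List.Membership.DecPropositional using () renaming (_∈?_ to member?)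
open import Data.Product using (∃-syntax; _×_; _,_; proj₁; proj₂)
open import Data.Product.Properties using (≡-dec)
open import Data.Sum using (_⊎_; inj₁; inj₂)
open import Data.Empty using (⊥-elim)
open import Data.Vec using (tabulate)
open import Data.Vec.Properties using (lookup∘tabulate; []=⇒lookup; lookup⇒[]=)
open import Function using (_∘_; flip)
open import Induction.WellFounded using (Acc; acc; WellFounded)
open import Relation.Binary.Core using (Rel)
open import Relation.Binary.Definitions using (Decidable; Transitive)
open import Relation.Binary.Structures using (IsStrictPartialOrder)
import Relation.Binary.Construct.StrictToNonStrict as StrictToNonStrict
open import Relation.Binary.PropositionalEquality using (_≡_; refl; sym; trans; subst; isEquivalence; resp₂)
open import Relation.Nullary using (¬_; Dec; yes; no; does)
open import Relation.Nullary.Decidable using (map′; _×-dec_; _⊎-dec_; _→-dec_; ¬?; dec-true)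
open import Relation.Unary using (Pred)
import Relation.Unary as U

⊆⇒length-<-∷ʳ : ∀ {A : Set} {xs ys : List A} {a : A} → xs ⊆ ys → length xs < length (ys ++ [ a ])
⊆⇒length-<-∷ʳ {xs = xs} {ys} xs⊆ys =
  subst (length xs <_) (sym (trans (length-++ ys) (+-comm _ 1))) (s≤s (length-mono-≤ xs⊆ys))

module PathProperties {S : Set} {k : ℕ} (E : S → Fin k → S → Set) where
  open Generic E

  _▻_ : ∀ {x ws y a z} → PathFrom x ws y → E y a z → PathFrom x (ws ++ [ a ]) z
  nil      ▻ e = cons e nil
  cons e′ p ▻ e = cons e′ (p ▻ e)

  data SnocView (x : S) : List (Fin k) → S → Set where
    ε    : SnocView x [] x
    snoc : ∀ {ws y a z} → PathFrom x ws y → E y a z → SnocView x (ws ++ [ a ]) z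

  snocView : ∀ {x ws y} → PathFrom x ws y → SnocView x ws y
  snocView nil = ε
  snocView (cons e p) with snocView p
  ... | ε        = snoc nil e
  ... | snoc q e′ = snoc (cons e q) e′

  Covers-resp-⊆ : ∀ {i s t v} → s ⊆ t → Covers i s v → Covers i t v
  Covers-resp-⊆ s⊆t (ws , p , ws⊆s) = ws , p , ⊆-trans ws⊆s s⊆t

  Covers-▻ : ∀ {i s x a y} → Covers i s x → E x a y → Covers i (s ++ [ a ]) y
  Covers-▻ (ws , p , ws⊆s) e = ws ++ [ _ ] , p ▻ e , ++⁺ ws⊆s ⊆-refl

module _ {n p} {P : Pred (Fin n) p} (P? : U.Decidable P) where

  toSubset : Subset n
  toSubset = tabulate (does ∘ P?)

  ∈-toSubset⁺ : ∀ {x} → P x → x ∈ₛ toSubset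
  ∈-toSubset⁺ {x} px = lookup⇒[]= x toSubset (trans (lookup∘tabulate (does ∘ P?) x) (dec-true (P? x) px))

  ∈-toSubset⁻ : ∀ {x} → x ∈ₛ toSubset → P x
  ∈-toSubset⁻ {x} x∈ with P? x | trans (sym (lookup∘tabulate (does ∘ P?) x)) ([]=⇒lookup x∈)
  ... | yes px | _ = px
  ... | no _   | ()

module MinimalElements {n ℓ} {_⊏_ : Rel (Fin n) ℓ}
                       (isSPO : IsStrictPartialOrder _≡_ _⊏_) (_⊏?_ : Decidable _⊏_) where
  open IsStrictPartialOrder isSPO using (<-respˡ-≈) renaming (trans to ⊏-trans)
  open StrictToNonStrict _≡_ _⊏_ using (_≤_; ≤-<-trans)

  Minimal : ∀ {p} → Pred (Fin n) p → Pred (Fin n) _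
  Minimal P x = P x × (∀ y → P y → ¬ y ⊏ x)

  minimal? : ∀ {p} {P : Pred (Fin n) p} → U.Decidable P → U.Decidable (Minimal P)
  minimal? P? x = P? x ×-dec all? (λ y → P? y →-dec ¬? (y ⊏? x))

  minimal-below : ∀ {p} {P : Pred (Fin n) p} → U.Decidable P →
                  ∀ {x} → P x → ∃[ w ] (Minimal P w × w ≤ x)
  minimal-below {P = P} P? px = go (spo-wellFounded isSPO _) px
    where
    go : ∀ {x} → Acc _⊏_ x → P x → ∃[ w ] (Minimal P w × w ≤ x)
    go {x} (acc rs) px with any? (λ y → P? y ×-dec y ⊏? x)
    ... | no ∄y = x , (px , λ y py y⊏x → ∄y (y , py , y⊏x)) , inj₂ refl
    ... | yes (y , py , y⊏x) with go (rs y⊏x) py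
    ...   | w , min , w≤y = w , min , inj₁ (≤-<-trans sym ⊏-trans <-respˡ-≈ w≤y y⊏x)

module Machines {n k : ℕ} (M : Machine n k) where
  open Machine M
  open Generic (Edge M)
  open PathProperties (Edge M)
  module S where
    open Generic (SEdge M) public
    open PathProperties (SEdge M) public

  edge? : ∀ w a v → Dec (Edge M w a v)
  edge? w a v = member? (≡-dec _≟ᶠ_ (≡-dec _≟ᶠ_ _≟ᶠ_)) (w , a , v) edges

  Anc-trans : Transitive (Anc M)
  Anc-trans (par e)    r = step e r
  Anc-trans (step e q) r = step e (Anc-trans q r)

  open StrictToNonStrict _≡_ (Anc M) public using () renaming (_≤_ to _≼_)

  ≼-trans : Transitive _≼_
  ≼-trans = StrictToNonStrict.trans _≡_ (Anc M) isEquivalence (resp₂ (Anc M)) Anc-trans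

  ≼⇒path : ∀ {x y} → x ≼ y → ∃[ ws ] PathFrom x ws y
  ≼⇒path (inj₁ (par e))    = _ , cons e nil
  ≼⇒path (inj₁ (step e r)) = let _ , p = ≼⇒path (inj₁ r) in _ , cons e p
  ≼⇒path (inj₂ refl)       = [] , nil

  path⇒Anc : ∀ {x a ws y} → PathFrom x (a ∷ ws) y → Anc M x y
  path⇒Anc (cons e nil)        = par e
  path⇒Anc (cons e (cons e′ p)) = step e (path⇒Anc (cons e′ p))

  Anc-decidable : WellFounded (flip (Anc M)) → Decidable (Anc M)
  Anc-decidable wf x y = go (wf x)
    where
    ChildTowards : Fin n → Fin n → Set
    ChildTowards x z = (∃[ a ] Edge M x a z) × (z ≡ y ⊎ Anc M z y)

    fromChild : ∀ {x} → ∃[ z ] ChildTowards x z → Anc M x y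
    fromChild (_ , (_ , e) , inj₁ refl) = par e
    fromChild (_ , (_ , e) , inj₂ r)    = step e r

    toChild : ∀ {x} → Anc M x y → ∃[ z ] ChildTowards x z
    toChild (par e)    = _ , (_ , e) , inj₁ refl
    toChild (step e r) = _ , (_ , e) , inj₂ r

    go : ∀ {x} → Acc (flip (Anc M)) x → Dec (Anc M x y)
    go {x} (acc rs) = map′ fromChild toChild (any? childTowards?)
      where
      childTowards? : ∀ z → Dec (ChildTowards x z)
      childTowards? z with any? (λ a → edge? x a z)
      ... | no ¬e = no (¬e ∘ proj₁)
      ... | yes (a , e) = map′ ((a , e) ,_) proj₂ ((z ≟ᶠ y) ⊎-dec go (rs (par e)))

  Antichain : Subset n → Set
  Antichain U = ∀ {x y} → x ∈ₛ U → y ∈ₛ U → ¬ Anc M x y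

  par-antichain : ∀ {V a W} → IsPar M V a W → Antichain W
  par-antichain isPar {x} {y} x∈W y∈W = proj₂ (proj₁ (isPar y) y∈W) x (proj₁ (proj₁ (isPar x) x∈W))

  Cl-antichain : ∀ {V U} → Antichain V → Cl M V U → Antichain U
  Cl-antichain anti here                 = anti
  Cl-antichain _    (there _ isPar V⊢U) = Cl-antichain (par-antichain isPar) V⊢U

  par-below : ∀ {V a W x} → IsPar M V a W → x ∈ₛ W → ∃[ v ] (v ∈ₛ V × x ≼ v)
  par-below isPar x∈W with proj₁ (proj₁ (isPar _) x∈W)
  ... | inj₁ (v , v∈V , e) = v , v∈V , inj₁ (par e)
  ... | inj₂ x∈V           = _ , x∈V , inj₂ refl

  Cl-below : ∀ {V U x} → Cl M V U → x ∈ₛ U → ∃[ v ] (v ∈ₛ V × x ≼ v)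
  Cl-below here                 x∈U = _ , x∈U , inj₂ refl
  Cl-below (there _ isPar W⊢U) x∈U with Cl-below W⊢U x∈U
  ... | w , w∈W , x≼w with par-below isPar w∈W
  ...   | v , v∈V , w≼v = v , v∈V , ≼-trans x≼w w≼v

  Cl-trans : ∀ {V U W} → Cl M V U → Cl M U W → Cl M V W
  Cl-trans here                U⊢W = U⊢W
  Cl-trans (there inc isPar c) U⊢W = there inc isPar (Cl-trans c U⊢W)

  SEdge⇒SState : ∀ {W a V} → SEdge M W a V → SState M W
  SEdge⇒SState ((v , v⊢V) , inc , isPar) = v , Cl-trans v⊢V (there inc isPar here)

  Covers-par⁺ : ∀ {V a W x s} → IsPar M V a W → x ∈ₛ W → Covers init s x →
               ∃[ v ] (v ∈ₛ V × Covers init (s ++ [ a ]) v)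
  Covers-par⁺ isPar x∈W c with proj₁ (proj₁ (isPar _) x∈W)
  ... | inj₁ (v , v∈V , e) = v , v∈V , Covers-▻ c e
  ... | inj₂ x∈V           = _ , x∈V , Covers-resp-⊆ (++⁺ʳ _ ⊆-refl) c

  S-path⇒Covers : ∀ {X ws U x s} → S.PathFrom X ws U → x ∈ₛ X → Covers init s x →
                  ∃[ u ] (u ∈ₛ U × Covers init (s ++ ws) u)
  S-path⇒Covers S.nil x∈X c = _ , x∈X , Covers-resp-⊆ (++⁺ʳ [] ⊆-refl) c
  S-path⇒Covers {s = s} (S.cons {a = a} {ws = ws} (_ , _ , isPar) p) x∈X c with Covers-par⁺ isPar x∈X c
  ... | y , y∈Y , c′ = subst (λ t → ∃[ u ] (u ∈ₛ _ × Covers init t u)) (++-assoc s [ a ] ws)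
                             (S-path⇒Covers p y∈Y c′)

  S-Covers⇒Covers : ∀ {s U} → S.Covers (SInit M) s U → ∃[ u ] (u ∈ₛ U × Covers init s u)
  S-Covers⇒Covers (ws , p , ws⊆s) with S-path⇒Covers p (x∈⁅x⁆ init) ([] , nil , [])
  ... | u , u∈U , c = u , u∈U , Covers-resp-⊆ ws⊆s c

  module _ (acyclic : ∀ v → ¬ Anc M v v) where

    Anc-isStrictPartialOrder : IsStrictPartialOrder _≡_ (Anc M)
    Anc-isStrictPartialOrder = record
      { isEquivalence = isEquivalence
      ; irrefl        = λ { refl → acyclic _ }
      ; trans         = Anc-trans
      ; <-resp-≈      = resp₂ (Anc M)
      }

    open MinimalElements Anc-isStrictPartialOrder
                         (Anc-decidable (spo-noetherian Anc-isStrictPartialOrder))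

    InSubU? : ∀ V a → U.Decidable (InSubU M V a)
    InSubU? V a x = any? (λ v → (v ∈ₛ? V) ×-dec edge? x a v) ⊎-dec (x ∈ₛ? V)

    parSet : Subset n → Fin k → Subset n
    parSet V a = toSubset (minimal? (InSubU? V a))

    parSet-isPar : ∀ V a → IsPar M V a (parSet V a)
    parSet-isPar V a x = ∈-toSubset⁻ (minimal? (InSubU? V a)) , ∈-toSubset⁺ (minimal? (InSubU? V a))

    parSet-SEdge : ∀ {U z a u} → SState M U → u ∈ₛ U → Edge M z a u → SEdge M (parSet U a) a U
    parSet-SEdge U-state u∈U e = U-state , (_ , _ , u∈U , e) , parSet-isPar _ _

    ⁅⁆-antichain : ∀ v → Antichain ⁅ v ⁆
    ⁅⁆-antichain v x∈ y∈ rewrite x∈⁅y⁆⇒x≡y v x∈ | x∈⁅y⁆⇒x≡y v y∈ = acyclic v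

    module _ (mono : IsMonotonic M) where

      Covers-Anc : ∀ {s w x} → Anc M w x → Covers init s x → Covers init s w
      Covers-Anc (par e)    c = mono _ _ _ _ e c
      Covers-Anc (step e r) c = mono _ _ _ _ e (Covers-Anc r c)

      Covers-≼ : ∀ {s w x} → w ≼ x → Covers init s x → Covers init s w
      Covers-≼ (inj₁ r)    = Covers-Anc r
      Covers-≼ (inj₂ refl) c = c

      Covers-par⁻ : ∀ {V a W x s} → IsPar M V a W → InSubU M V a x → Covers init s x →
                    ∃[ w ] (w ∈ₛ W × Covers init s w)
      Covers-par⁻ {V} {a} isPar x∈ c with minimal-below (InSubU? V a) x∈
      ... | w , w-min , w≼x = w , proj₂ (isPar w) w-min , Covers-≼ w≼x c

      -- U is an antichain of states ≼ v; as init ≼ v, monotonicity makes every y ∈ U reachable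
      -- from init, and a nonempty such path would put init strictly below y.
      SState-init : ∀ {U} → SState M U → init ∈ₛ U → U ≡ ⁅ init ⁆
      SState-init {U} (v , v⊢U) init∈U =
        ⊆-antisym (λ y∈U → subst (_∈ₛ ⁅ init ⁆) (sym (only-init y∈U)) (x∈⁅x⁆ init))
                  (λ y∈⁅init⁆ → subst (_∈ₛ U) (sym (x∈⁅y⁆⇒x≡y init y∈⁅init⁆)) init∈U)
        where
        below-v : ∀ {x} → x ∈ₛ U → x ≼ v
        below-v x∈U with Cl-below v⊢U x∈U
        ... | v′ , v′∈⁅v⁆ , x≼v′ = subst (_ ≼_) (x∈⁅y⁆⇒x≡y v v′∈⁅v⁆) x≼v′

        only-init : ∀ {y} → y ∈ₛ U → y ≡ init
        only-init y∈U with ≼⇒path (below-v init∈U)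
        ... | ws , p with Covers-≼ (below-v y∈U) (ws , p , ⊆-refl)
        ...   | _ , nil      , _ = refl
        ...   | _ , cons e q , _ = ⊥-elim (Cl-antichain (⁅⁆-antichain v) v⊢U init∈U y∈U (path⇒Anc (cons e q)))

      -- Monotonicity replaces the path by a different one, so the induction is on its length.
      path⇒S-Covers : ∀ {U u ws} → Acc _<_ (length ws) → SState M U → u ∈ₛ U → PathFrom init ws u →
                      S.Covers (SInit M) ws U
      path⇒S-Covers (acc rs) U-state u∈U p with snocView p
      ... | ε = [] , subst (S.PathFrom (SInit M) []) (sym (SState-init U-state u∈U)) S.nil , []
      ... | snoc {ps} {a = a} q e
        with Covers-par⁻ (parSet-isPar _ a) (inj₁ (_ , u∈U , e)) (ps , q , ⊆-refl)
      ...   | w , w∈W , ps′ , q′ , ps′⊆ps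
        with path⇒S-Covers (rs (⊆⇒length-<-∷ʳ ps′⊆ps)) (SEdge⇒SState (parSet-SEdge U-state u∈U e)) w∈W q′
      ...     | qs , r , qs⊆ps′ =
        qs ++ [ a ] , r S.▻ parSet-SEdge U-state u∈U e , ++⁺ (⊆-trans qs⊆ps′ ps′⊆ps) ⊆-refl

      Covers⇒S-Covers : ∀ {U u s} → SState M U → u ∈ₛ U → Covers init s u → S.Covers (SInit M) s U
      Covers⇒S-Covers U-state u∈U (ws , p , ws⊆s) =
        S.Covers-resp-⊆ ws⊆s (path⇒S-Covers (<-wellFounded _) U-state u∈U p)

      S-monotonic : SIsMonotonic M
      S-monotonic s W a V edge@(_ , _ , isPar) V-covered with S-Covers⇒Covers V-covered
      ... | u , u∈V , u-covered with Covers-par⁻ isPar (inj₂ u∈V) u-covered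
      ...   | w , w∈W , w-covered = Covers⇒S-Covers (SEdge⇒SState edge) w∈W w-covered

mainTheorem6 : (n k : ℕ) (M : Machine n k) →
    IsMachine M → IsMonotonic M → SIsMonotonic M
mainTheorem6 n k M (acyclic , _) mono = Machines.S-monotonic M acyclic mono
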